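{- Let $(p,R)$ and $(p,R')$ be vincular patterns where $p\in\mathfrak{S}_k$. If $\mathrm{enc}(p,R)=\mathrm{enc}(p,R')$, then $(p,R)\asymp(p,R')$. If, moreover, $k>3$, then $R=R'$.
   Context: A mesh pattern is a pair $(p,R)$ where $p\in\mathfrak{S}_k$ and $R\subseteq\{0,\dots,k\}^2$, where $(a,b)\in R$ denotes the unit square $[a,a+1]\times[b,b+1]$ in $[0,k+1]^2$; $G(p)=\{(i,p(i)):i\in[1,k]\}$. It is vincular if $R$ is a union of complete columns, i.e. whenever $(i,y)\in R$ for some $y$, then $(i,y')\in R$ for all $y'\in\{0,\dots,k\}$. A permutation $w\in\mathfrak{S}_n$ contains $(p,R)$ if there are indices $1\le i_1<\dots<i_k\le n$ with $w(i_1)\cdots w(i_k)$ order isomorphic to $p$ such that, setting $i_0=0$, $i_{k+1}=n+1$, $v_0=0$, $v_{k+1}=n+1$ and $v_b=w(i_{p^{ -1}(b)})$ for $b\in[1,k]$, for every $(a,b)\in R$ the open rectangle $(i_a,i_{a+1})\times(v_b,v_{b+1})$ contains no point $(x,w(x))$. Mesh patterns $\pi,\sigma$ are coincident, $\pi\asymp\sigma$, if they are avoided by exactly the same permutations (of all sizes). Enclosed diagonals: for integers $a,b\ge0$, $c\ge1$, $D=\{(a+i,b+i): i\in[0,c]\}\subseteq R$ is an enclosed NE-diagonal if $\{(a+i,b+i): i\in[0,c+1]\}\cap G(p)=\{(a+i,b+i): i\in[1,c]\}$ (lattice points), and $D=\{(a+i,b-i): i\in[0,c]\}\subseteq R$ is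 an enclosed SE-diagonal if $\{(a+i,b+1-i): i\in[0,c+1]\}\cap G(p)=\{(a+i,b+1-i): i\in[1,c]\}$. Also, a single square $\{(a,b)\}\subseteq R$ none of whose four corners lies in $G(p)$ (a pointless square) is an enclosed diagonal of length $1$. $\mathrm{enc}(p,R)$ is the set of all enclosed diagonals of $(p,R)$. -}

module Defs where

open import Data.Nat as ℕ using (ℕ; zero; suc; _+_; _∸_; _<?_)
open import Data.Fin as Fin using (Fin; toℕ; fromℕ<)
open import Data.Fin.Permutation using (Permutation′; _⟨$⟩ʳ_; _⟨$⟩ˡ_)
open import Data.Bool using (Bool; true)
open import Data.Product using (Σ; ∃; _×_; _,_)
open import Function.Bundles using (_⇔_)
open import Relation.Nullary using (¬_; yes; no)
open import Relation.Binary.PropositionalEquality using (_≡_)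

-- Shaded region R ⊆ {0,…,k}², as a characteristic function:
-- R a b ≡ true  iff the unit square (a,b) (= [a,a+1]×[b,b+1]) is shaded.
Region : ℕ → Set
Region k = Fin (suc k) → Fin (suc k) → Bool

Vincular : ∀ {k} → Region k → Set
Vincular {k} R = ∀ (a y y' : Fin (suc k)) → R a y ≡ true → R a y' ≡ true

-- Square (a,b) ∈ R, with a,b natural numbers (false if out of range).
InR : ∀ {k} → Region k → ℕ → ℕ → Set
InR {k} R a b = Σ (Fin (suc k)) λ i → Σ (Fin (suc k)) λ j →
  toℕ i ≡ a × toℕ j ≡ b × R i j ≡ true

-- Lattice point (x,y) ∈ G(p) = {(i,p(i)) : i ∈ [1,k]}  (1-based; Fin k is 0-based).
InG : ∀ {k} → Permutation′ k → ℕ → ℕ → Set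
InG {k} p x y = Σ (Fin k) λ i → suc (toℕ i) ≡ x × suc (toℕ (p ⟨$⟩ʳ i)) ≡ y

-- Candidate diagonals (each describes a distinct set of squares):
--   NE a b c : {(a+i,b+i) : i ∈ [0,c]}    (c ≥ 1)
--   SE a b c : {(a+i,b-i) : i ∈ [0,c]}    (c ≥ 1, c ≤ b)
--   single a b : {(a,b)}
data Diag : Set where
  NE SE : ℕ → ℕ → ℕ → Diag
  single : ℕ → ℕ → Diag

Enc : ∀ {k} → Permutation′ k → Region k → Diag → Set
Enc p R (NE a b c) =
  1 ℕ.≤ c
  × (∀ i → i ℕ.≤ c → InR R (a + i) (b + i))
  × (∀ i → i ℕ.≤ suc c → (InG p (a + i) (b + i) ⇔ (1 ℕ.≤ i × i ℕ.≤ c)))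
Enc p R (SE a b c) =
  1 ℕ.≤ c × c ℕ.≤ b
  × (∀ i → i ℕ.≤ c → InR R (a + i) (b ∸ i))
  × (∀ i → i ℕ.≤ suc c → (InG p (a + i) (suc b ∸ i) ⇔ (1 ℕ.≤ i × i ℕ.≤ c)))
Enc p R (single a b) =
  InR R a b
  × ¬ InG p a b × ¬ InG p (suc a) b × ¬ InG p a (suc b) × ¬ InG p (suc a) (suc b)

-- Extend a 1-based family f(1..k) by f(0) = 0 and f(m) = top for m > k
-- (only m = k+1 is ever used).  Argument of f is the 0-based index.
extend : ∀ {k} → (Fin k → ℕ) → ℕ → ℕ → ℕ
extend f top zero = 0
extend {k} f top (suc m) with m <? k
... | yes m<k = f (fromℕ< m<k)
... | no _ = top

-- Occurrence of (p,R) in w ∈ 𝔖ₙ via indices ι (0-based) i_1 < … < i_k.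
Occurrence : ∀ {k n} → Permutation′ k → Region k → Permutation′ n → (Fin k → Fin n) → Set
Occurrence {k} {n} p R w ι =
  (∀ j j' → j Fin.< j' → ι j Fin.< ι j')
  × (∀ j j' → ((w ⟨$⟩ʳ ι j) Fin.< (w ⟨$⟩ʳ ι j') ⇔ (p ⟨$⟩ʳ j) Fin.< (p ⟨$⟩ʳ j')))
  × (∀ (a b : Fin (suc k)) → R a b ≡ true → ∀ (x : Fin n) →
       ¬ ( I (toℕ a) ℕ.< suc (toℕ x) × suc (toℕ x) ℕ.< I (suc (toℕ a))
         × V (toℕ b) ℕ.< suc (toℕ (w ⟨$⟩ʳ x)) × suc (toℕ (w ⟨$⟩ʳ x)) ℕ.< V (suc (toℕ b))))
  where
    -- i_a, with i_0 = 0, i_{k+1} = n+1 (1-based positions)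
    I : ℕ → ℕ
    I = extend (λ j → suc (toℕ (ι j))) (suc n)
    -- v_b = w(i_{p⁻¹(b)}), with v_0 = 0, v_{k+1} = n+1
    V : ℕ → ℕ
    V = extend (λ b → suc (toℕ (w ⟨$⟩ʳ ι (p ⟨$⟩ˡ b)))) (suc n)

Contains : ∀ {k n} → Permutation′ n → Permutation′ k → Region k → Set
Contains {k} {n} w p R = ∃ λ (ι : Fin k → Fin n) → Occurrence p R w ι

Avoids : ∀ {k n} → Permutation′ n → Permutation′ k → Region k → Set
Avoids w p R = ¬ Contains w p R

Coincident : ∀ {k k'} → Permutation′ k → Region k → Permutation′ k' → Region k' → Set
Coincident p R p' R' = ∀ n (w : Permutation′ n) → (Avoids w p R ⇔ Avoids w p' R')

module Submission where

-- For a vincular pattern, whether an increasing, order-isomorphic choice ι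
-- of entries of w is an occurrence of (p,R) depends only on the set of shaded columns:
-- column a is shaded exactly when w has no entry strictly between the a-th and
-- (a+1)-st chosen positions (gap-empty, occurrence-from-gaps).  So an occurrence of
-- (p,R) is one of (p,R') whenever R shades every column that R' shades (transfer).
-- Enclosed diagonals transfer shading: a pointless square in a column shaded by R'
-- is an enclosed diagonal of (p,R'), hence of (p,R) (pointless-shaded).  For k ≥ 4
-- every column contains a pointless square (pointless-row), so R and R' shade the same
-- columns; this gives both coincidence and R = R'.  For k ≤ 3 we inspect the finitely
-- many p.  A column without pointless square that R' shades but R does not is flanked
-- by enclosed diagonals of length two (pair-NE, pair-SE) forcing its neighbours to be
-- unshaded in R'; a discrete intermediate value argument (crossing) then slides the
-- two chosen entries around that column to adjacent positions of w, giving an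
-- occurrence of (p,R').  Hence enc(p,R') ⊆ enc(p,R) makes containment of (p,R) imply
-- containment of (p,R') (enc-monotone), and the theorem follows in both directions.

open import Defs
open import Data.Nat as ℕ using (ℕ; zero; suc; _+_; _∸_; _<?_; _≤?_; z≤n; s≤s; _≤_; _<_)
import Data.Nat.Properties as ℕₚ
open import Data.Fin as Fin using (Fin; toℕ; fromℕ<; fromℕ)
open import Data.Fin.Patterns using (0F; 1F; 2F; 3F)
open import Data.Fin.Properties
  using (toℕ-injective; toℕ-fromℕ<; fromℕ<-toℕ; toℕ<n; toℕ-fromℕ; any?; <⇒≢) renaming (_<?_ to _<ᶠ?_)
open import Data.Fin.Permutation using (Permutation′; _⟨$⟩ʳ_; _⟨$⟩ˡ_; inverseˡ)
open import Data.Bool using (true; false)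
open import Data.Bool.Properties using () renaming (_≟_ to _≟ᵇ_)
open import Data.Product using (Σ; ∃; _×_; _,_; proj₁; proj₂)
open import Data.Sum using (inj₁; inj₂)
open import Data.Empty using (⊥)
open import Function.Bundles using (_⇔_; mk⇔; Equivalence; Injection)
open import Function.Properties.Inverse using (↔⇒↣)
open import Relation.Nullary using (¬_; yes; no; Dec; contradiction)
open import Relation.Nullary.Decidable using (True; False; toWitness; toWitnessFalse; _×-dec_)
open import Relation.Binary.PropositionalEquality
open import Relation.Binary.Definitions using (tri<; tri≈; tri>)

permutation-injective : ∀ {n} (π : Permutation′ n) {i j : Fin n} → π ⟨$⟩ʳ i ≡ π ⟨$⟩ʳ j → i ≡ j
permutation-injective π = Injection.injective (↔⇒↣ π)

extend-inside : ∀ {k} (f : Fin k → ℕ) top m (m<k : m < k) → extend f top (suc m) ≡ f (fromℕ< m<k)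
extend-inside {k} f top m m<k with m <? k
... | yes _ = refl
... | no m≮k = contradiction m<k m≮k

extend-top : ∀ {k} (f : Fin k → ℕ) top → extend f top (suc k) ≡ top
extend-top {k} f top with k <? k
... | yes k<k = contradiction k<k (ℕₚ.<-irrefl refl)
... | no _ = refl

position : ∀ {k n} → (Fin k → Fin n) → ℕ → ℕ
position {n = n} ι = extend (λ j → suc (toℕ (ι j))) (suc n)

position-chosen : ∀ {k n} (ι : Fin k → Fin n) j → position ι (suc (toℕ j)) ≡ suc (toℕ (ι j))
position-chosen ι j =
  trans (extend-inside _ _ (toℕ j) (toℕ<n j)) (cong (λ i → suc (toℕ (ι i))) (fromℕ<-toℕ j (toℕ<n j)))

position-top : ∀ {k n} (ι : Fin k → Fin n) → position ι (suc k) ≡ suc n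
position-top {k} ι = extend-top {k} _ _

Increasing : ∀ {k n} → (Fin k → Fin n) → Set
Increasing ι = ∀ j j' → j Fin.< j' → ι j Fin.< ι j'

position-mono : ∀ {k n} (ι : Fin k → Fin n) → Increasing ι
  → ∀ u v → u < v → v ≤ suc k → position ι u < position ι v
position-mono {k} ι inc zero (suc v) _ _ with v <? k
... | yes _ = s≤s z≤n
... | no _ = s≤s z≤n
position-mono {k} ι inc (suc u) (suc v) (s≤s u<v) (s≤s v≤k) with ℕₚ.m≤n⇒m<n∨m≡n v≤k
... | inj₁ v<k =
  subst₂ _<_ (sym (extend-inside _ _ u u<k)) (sym (extend-inside _ _ v v<k))
    (s≤s (inc _ _ (subst₂ _<_ (sym (toℕ-fromℕ< u<k)) (sym (toℕ-fromℕ< v<k)) u<v)))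
  where
  u<k : u < k
  u<k = ℕₚ.<-trans u<v v<k
... | inj₂ refl =
  subst₂ _<_ (sym (extend-inside _ _ u u<v)) (sym (position-top ι)) (s≤s (toℕ<n _))

position-mono≤ : ∀ {k n} (ι : Fin k → Fin n) → Increasing ι
  → ∀ u v → u ≤ v → v ≤ suc k → position ι u ≤ position ι v
position-mono≤ ι inc u v u≤v v≤ with ℕₚ.m≤n⇒m<n∨m≡n u≤v
... | inj₁ u<v = ℕₚ.<⇒≤ (position-mono ι inc u v u<v v≤)
... | inj₂ refl = ℕₚ.≤-refl

position-reflect : ∀ {k n} (ι : Fin k → Fin n) → Increasing ι
  → ∀ {u v} → u ≤ suc k → position ι u < position ι v → u < v
position-reflect ι inc {u} {v} u≤ lt =
  ℕₚ.≰⇒> (λ v≤u → ℕₚ.<⇒≱ lt (position-mono≤ ι inc v u v≤u u≤))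

InGap : ∀ {k n} → (Fin k → Fin n) → Fin (suc k) → Fin n → Set
InGap ι a x = position ι (toℕ a) < suc (toℕ x) × suc (toℕ x) < position ι (suc (toℕ a))

gap-unchosen : ∀ {k n} (ι : Fin k → Fin n) → Increasing ι
  → ∀ {a x} → InGap ι a x → ∀ j → ι j ≢ x
gap-unchosen ι inc {a} (lo , hi) j refl = ℕₚ.<⇒≱ j<a a≤j
  where
  a≤j : toℕ a ≤ toℕ j
  a≤j = ℕₚ.≤-pred (position-reflect ι inc (ℕₚ.m≤n⇒m≤1+n (ℕₚ.≤-pred (toℕ<n a)))
          (subst (position ι (toℕ a) <_) (sym (position-chosen ι j)) lo))
  j<a : toℕ j < toℕ a
  j<a = ℕₚ.≤-pred (position-reflect ι inc (s≤s (ℕₚ.<⇒≤ (toℕ<n j)))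
          (subst (_< position ι (suc (toℕ a))) (sym (position-chosen ι j)) hi))

bracket : (f : ℕ → ℕ) (y m : ℕ) → f 0 < y → y < f m → (∀ i → i ≤ m → f i ≢ y)
  → ∃ λ b → b < m × f b < y × y < f (suc b)
bracket f y zero f0<y y<f0 _ = contradiction y<f0 (ℕₚ.<-asym f0<y)
bracket f y (suc m) f0<y y<fm missed with ℕₚ.<-cmp (f m) y
... | tri< fm<y _ _ = m , ℕₚ.≤-refl , fm<y , y<fm
... | tri≈ _ fm≡y _ = contradiction fm≡y (missed m (ℕₚ.n≤1+n m))
... | tri> _ _ y<fm' =
  let (b , b<m , bounds) = bracket f y m f0<y y<fm' (λ i i≤m → missed i (ℕₚ.m≤n⇒m≤1+n i≤m))
  in b , ℕₚ.m<n⇒m<1+n b<m , bounds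

value : ∀ {k n} → Permutation′ k → Permutation′ n → (Fin k → Fin n) → ℕ → ℕ
value {n = n} p w ι = extend (λ b → suc (toℕ (w ⟨$⟩ʳ ι (p ⟨$⟩ˡ b)))) (suc n)

Shaded : ∀ {k} → Region k → Fin (suc k) → Set
Shaded R a = ∃ λ b → R a b ≡ true

shaded? : ∀ {k} (R : Region k) a → Dec (Shaded R a)
shaded? R a = any? (λ b → R a b ≟ᵇ true)

column-full : ∀ {k} {R : Region k} → Vincular R → ∀ {a} → Shaded R a → ∀ b → R a b ≡ true
column-full vR {a} (y , Ray) b = vR a y b Ray

-- In an occurrence of a vincular pattern, the gap below a shaded column is empty:
-- an entry x in it has a value strictly between two consecutive v_b, so it would lie
-- in the shaded square (a, b).
gap-empty : ∀ {k n} {p : Permutation′ k} {R : Region k} {w : Permutation′ n} {ι : Fin k → Fin n}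
  → Vincular R → Occurrence p R w ι → ∀ {a} → Shaded R a → ∀ x → ¬ InGap ι a x
gap-empty {k} {n} {p} {R} {w} {ι} vR (inc , _ , avoids) {a} (b₀ , Ra) x gap =
  in-square (bracket (value p w ι) y (suc k) (s≤s z≤n) below-top unvalued)
  where
  y : ℕ
  y = suc (toℕ (w ⟨$⟩ʳ x))
  unvalued : ∀ i → i ≤ suc k → value p w ι i ≢ y
  unvalued zero _ ()
  unvalued (suc m) _ e with m <? k
  ... | yes m<k = gap-unchosen ι inc gap (p ⟨$⟩ˡ fromℕ< m<k)
                    (permutation-injective w (toℕ-injective (ℕₚ.suc-injective e)))
  ... | no _ = ℕₚ.<-irrefl (sym e) (s≤s (toℕ<n _))
  below-top : y < value p w ι (suc k)
  below-top = subst (y <_) (sym (extend-top {k} _ _)) (s≤s (toℕ<n _))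
  in-square : (∃ λ b → b < suc k × value p w ι b < y × y < value p w ι (suc b)) → ⊥
  in-square (b , b< , below , above) =
    avoids a (fromℕ< b<) (column-full vR (b₀ , Ra) (fromℕ< b<)) x
      (proj₁ gap , proj₂ gap ,
       subst (λ c → value p w ι c < y) (sym (toℕ-fromℕ< b<)) below ,
       subst (λ c → y < value p w ι (suc c)) (sym (toℕ-fromℕ< b<)) above)

OrderIso : ∀ {k n} → Permutation′ k → Permutation′ n → (Fin k → Fin n) → Set
OrderIso p w ι = ∀ j j' → ((w ⟨$⟩ʳ ι j) Fin.< (w ⟨$⟩ʳ ι j') ⇔ (p ⟨$⟩ʳ j) Fin.< (p ⟨$⟩ʳ j'))

occurrence-from-gaps : ∀ {k n} {p : Permutation′ k} {R : Region k} {w : Permutation′ n} {ι : Fin k → Fin n}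
  → Increasing ι → OrderIso p w ι → (∀ a → Shaded R a → ∀ x → ¬ InGap ι a x) → Occurrence p R w ι
occurrence-from-gaps inc iso empty = inc , iso , λ a b Rab x (lo , hi , _) → empty a (b , Rab) x (lo , hi)

transfer : ∀ {k n} {p : Permutation′ k} {R R' : Region k} {w : Permutation′ n} {ι : Fin k → Fin n}
  → Vincular R → (∀ a → Shaded R' a → Shaded R a) → Occurrence p R w ι → Occurrence p R' w ι
transfer {p = p} {R} {R'} {w} vR columns occ@(inc , iso , _) =
  occurrence-from-gaps {p = p} {R = R'} {w = w} inc iso
    (λ a shaded → gap-empty {p = p} {R = R} {w = w} vR occ (columns a shaded))

order-iso : ∀ {k n} (p : Permutation′ k) (x : Fin k → Fin n)
  → (∀ s t → s Fin.< t → x (p ⟨$⟩ˡ s) Fin.< x (p ⟨$⟩ˡ t))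
  → ∀ u v → (x u Fin.< x v ⇔ (p ⟨$⟩ʳ u) Fin.< (p ⟨$⟩ʳ v))
order-iso p x mono u v = mk⇔ reflects (preserves u v)
  where
  preserves : ∀ u v → (p ⟨$⟩ʳ u) Fin.< (p ⟨$⟩ʳ v) → x u Fin.< x v
  preserves u v lt = subst₂ (λ a b → x a Fin.< x b) (inverseˡ p) (inverseˡ p) (mono _ _ lt)
  reflects : x u Fin.< x v → (p ⟨$⟩ʳ u) Fin.< (p ⟨$⟩ʳ v)
  reflects lt with ℕₚ.<-cmp (toℕ (p ⟨$⟩ʳ u)) (toℕ (p ⟨$⟩ʳ v))
  ... | tri< pu<pv _ _ = pu<pv
  ... | tri≈ _ pu≡pv _ =
    contradiction lt (ℕₚ.<-irrefl (cong (λ z → toℕ (x z)) (permutation-injective p (toℕ-injective pu≡pv))))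
  ... | tri> _ _ pv<pu = contradiction lt (ℕₚ.<-asym (preserves v u pv<pu))

fill : ∀ {k} {R : Region k} → Vincular R → ∀ {a} → Shaded R a → (b : Fin (suc k)) → InR R (toℕ a) (toℕ b)
fill vR {a} shaded b = a , b , refl , refl , column-full vR shaded b

shaded-column : ∀ {k} {R : Region k} {x y} → InR R x y → ∀ a → toℕ a ≡ x → Shaded R a
shaded-column (i , j , refl , _ , Rij) a ia with toℕ-injective ia
... | refl = j , Rij

Pointless : ∀ {k} → Permutation′ k → ℕ → ℕ → Set
Pointless p a b = ¬ InG p a b × ¬ InG p (suc a) b × ¬ InG p a (suc b) × ¬ InG p (suc a) (suc b)

-- G(p) meets the lattice points (a+i, b+i), i ≤ 2, exactly at i = 1: the squares
-- (a, b), (a+1, b+1) form an enclosed NE-diagonal of length two once they are shaded.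
NEFrame : ∀ {k} → Permutation′ k → ℕ → ℕ → Set
NEFrame p a b = ∀ i → i ≤ 2 → (InG p (a + i) (b + i) ⇔ (1 ≤ i × i ≤ 1))

-- The same for the SE-diagonal of squares (a, b), (a+1, b-1), through the lattice
-- points (a+i, b+1-i).
SEFrame : ∀ {k} → Permutation′ k → ℕ → ℕ → Set
SEFrame p a b = ∀ i → i ≤ 2 → (InG p (a + i) (suc b ∸ i) ⇔ (1 ≤ i × i ≤ 1))

frame : ∀ {P : ℕ → Set} → ¬ P 0 → P 1 → ¬ P 2 → ∀ i → i ≤ 2 → (P i ⇔ (1 ≤ i × i ≤ 1))
frame ¬P₀ _ _ 0 _ = mk⇔ (λ P₀ → contradiction P₀ ¬P₀) (λ { (() , _) })
frame _ P₁ _ 1 _ = mk⇔ (λ _ → ℕₚ.≤-refl , ℕₚ.≤-refl) (λ _ → P₁)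
frame _ _ ¬P₂ 2 _ = mk⇔ (λ P₂ → contradiction P₂ ¬P₂) (λ { (_ , s≤s ()) })
frame _ _ _ (suc (suc (suc _))) (s≤s (s≤s ()))

column-height : ∀ {k} (p : Permutation′ k) x → ∃ λ u → ∀ y → InG p x y → y ≡ u
column-height p zero = 0 , λ { _ (_ , () , _) }
column-height {k} p (suc x) with x <? k
... | yes x<k = suc (toℕ (p ⟨$⟩ʳ fromℕ< x<k)) , λ { y (i , ei , ey) →
      trans (sym ey) (cong (λ j → suc (toℕ (p ⟨$⟩ʳ j)))
        (toℕ-injective (trans (ℕₚ.suc-injective ei) (sym (toℕ-fromℕ< x<k))))) }
... | no x≮k = 0 , λ { _ (i , ei , _) → contradiction (subst (_< k) (ℕₚ.suc-injective ei) (toℕ<n i)) x≮k }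

Clear : ℕ → ℕ → Set
Clear b u = b ≢ u × suc b ≢ u

clear-below : ∀ {b u} → u < b → Clear b u
clear-below u<b = (λ e → ℕₚ.<-irrefl (sym e) u<b) , (λ e → ℕₚ.<-irrefl (sym e) (ℕₚ.m<n⇒m<1+n u<b))

clear-above : ∀ {b u} → suc b < u → Clear b u
clear-above {b} b+1<u =
  (λ e → ℕₚ.<-irrefl e (ℕₚ.<-trans (ℕₚ.n<1+n b) b+1<u)) , (λ e → ℕₚ.<-irrefl e b+1<u)

free-row-above : ∀ {u} → u ≤ 1 → ∀ v → ∃ λ b → b ≤ 4 × Clear b u × Clear b v
free-row-above u≤1 v with v ≤? 3
... | yes v≤3 =
  4 , ℕₚ.≤-refl , clear-below (ℕₚ.≤-trans (s≤s u≤1) (s≤s (s≤s z≤n))) , clear-below (s≤s v≤3)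
... | no v≰3 = 2 , s≤s (s≤s z≤n) , clear-below (s≤s u≤1) , clear-above (ℕₚ.≰⇒> v≰3)

-- Among the disjoint row pairs {0,1}, {2,3}, {4,5} one avoids any two heights.
free-row : ∀ u v → ∃ λ b → b ≤ 4 × Clear b u × Clear b v
free-row u v with u ≤? 1 | v ≤? 1
... | no u≰1 | no v≰1 = 0 , z≤n , clear-above (ℕₚ.≰⇒> u≰1) , clear-above (ℕₚ.≰⇒> v≰1)
... | yes u≤1 | _ = free-row-above u≤1 v
... | no _ | yes v≤1 with free-row-above v≤1 u
...   | b , b≤4 , avoid-v , avoid-u = b , b≤4 , avoid-u , avoid-v

-- For k ≥ 4 every column contains a pointless square: the lattice columns a and a+1
-- carry at most one point of G(p) each, blocking at most four of the k+1 ≥ 5 squares.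
pointless-row : ∀ {k} (p : Permutation′ k) → 3 < k → ∀ (a : Fin (suc k))
  → ∃ λ (b : Fin (suc k)) → Pointless p (toℕ a) (toℕ b)
pointless-row {k} p 3<k a with column-height p (toℕ a) | column-height p (suc (toℕ a))
... | u , at-u | v , at-v with free-row u v
...   | b , b≤4 , (b≢u , b+1≢u) , (b≢v , b+1≢v) =
  fromℕ< b<k+1 , subst (Pointless p (toℕ a)) (sym (toℕ-fromℕ< b<k+1))
    ((λ g → b≢u (at-u b g)) , (λ g → b≢v (at-v b g)) ,
     (λ g → b+1≢u (at-u (suc b) g)) , (λ g → b+1≢v (at-v (suc b) g)))
  where
  b<k+1 : b < suc k
  b<k+1 = s≤s (ℕₚ.≤-trans b≤4 3<k)

module EnclosedDiagonals {k} (p : Permutation′ k) {R R' : Region k} (vR' : Vincular R')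
                         (enc⊆ : ∀ d → Enc p R' d → Enc p R d) where

  -- A pointless square in a column shaded by R' is an enclosed diagonal of (p,R'),
  -- so R shades it, and with it the column.
  pointless-shaded : ∀ a b → Pointless p (toℕ a) (toℕ b) → Shaded R' a → Shaded R a
  pointless-shaded a b (c₁ , c₂ , c₃ , c₄) sa =
    shaded-column (proj₁ (enc⊆ (single (toℕ a) (toℕ b)) (fill vR' sa b , c₁ , c₂ , c₃ , c₄))) a refl

  -- If R' shades the adjacent columns a, a' = a+1 and the squares (a, b), (a+1, b+1)
  -- are framed by p, they form an enclosed diagonal of (p,R'), so R shades both columns.
  pair-NE : ∀ a a' b b' → toℕ a' ≡ toℕ a + 1 → toℕ b' ≡ toℕ b + 1 → NEFrame p (toℕ a) (toℕ b)
    → Shaded R' a → Shaded R' a' → Shaded R a × Shaded R a'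
  pair-NE a a' b b' ea eb framed sa sa' = columns (enc⊆ (NE (toℕ a) (toℕ b) 1) (ℕₚ.≤-refl , squares , framed))
    where
    squares : ∀ i → i ≤ 1 → InR R' (toℕ a + i) (toℕ b + i)
    squares 0 _ = subst₂ (InR R') (sym (ℕₚ.+-identityʳ _)) (sym (ℕₚ.+-identityʳ _)) (fill vR' sa b)
    squares 1 _ = subst₂ (InR R') ea eb (fill vR' sa' b')
    squares (suc (suc _)) (s≤s ())
    columns : Enc p R (NE (toℕ a) (toℕ b) 1) → Shaded R a × Shaded R a'
    columns (_ , inR , _) =
      shaded-column (inR 0 z≤n) a (sym (ℕₚ.+-identityʳ _)) , shaded-column (inR 1 ℕₚ.≤-refl) a' ea

  pair-SE : ∀ a a' b b' → toℕ a' ≡ toℕ a + 1 → toℕ b ≡ toℕ b' + 1 → SEFrame p (toℕ a) (toℕ b)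
    → Shaded R' a → Shaded R' a' → Shaded R a × Shaded R a'
  pair-SE a a' b b' ea eb framed sa sa' =
    columns (enc⊆ (SE (toℕ a) (toℕ b) 1)
      (ℕₚ.≤-refl , subst (1 ≤_) (sym eb) (ℕₚ.m≤n+m 1 _) , squares , framed))
    where
    b'≡b-1 : toℕ b' ≡ toℕ b ∸ 1
    b'≡b-1 = trans (sym (ℕₚ.m+n∸n≡m (toℕ b') 1)) (cong (_∸ 1) (sym eb))
    squares : ∀ i → i ≤ 1 → InR R' (toℕ a + i) (toℕ b ∸ i)
    squares 0 _ = subst (λ x → InR R' x (toℕ b)) (sym (ℕₚ.+-identityʳ _)) (fill vR' sa b)
    squares 1 _ = subst₂ (InR R') ea b'≡b-1 (fill vR' sa' b')
    squares (suc (suc _)) (s≤s ())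
    columns : Enc p R (SE (toℕ a) (toℕ b) 1) → Shaded R a × Shaded R a'
    columns (_ , _ , inR , _) =
      shaded-column (inR 0 z≤n) a (sym (ℕₚ.+-identityʳ _)) , shaded-column (inR 1 ℕₚ.≤-refl) a' ea

  columns-pointless : (∀ a → ∃ λ b → Pointless p (toℕ a) (toℕ b)) → ∀ a → Shaded R' a → Shaded R a
  columns-pointless rows a with rows a
  ... | b , pointless = pointless-shaded a b pointless

EncMonotone : ∀ {k} → Permutation′ k → Set
EncMonotone {k} p = ∀ {R R' : Region k} → Vincular R → Vincular R' → (∀ d → Enc p R' d → Enc p R d)
  → ∀ {n} (w : Permutation′ n) → Contains w p R → Contains w p R'

monotone-pointless : ∀ {k} (p : Permutation′ k)
  → (∀ a → ∃ λ b → Pointless p (toℕ a) (toℕ b)) → EncMonotone p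
monotone-pointless p rows vR vR' enc⊆ w (ι , occ) =
  ι , transfer {p = p} {w = w} vR (EnclosedDiagonals.columns-pointless p vR' enc⊆ rows) occ

columns-except : ∀ {k} {R R' : Region k} c → (Shaded R' c → Shaded R c)
  → (∀ a → a ≢ c → Shaded R' a → Shaded R a) → ∀ a → Shaded R' a → Shaded R a
columns-except c at-c others a with a Fin.≟ c
... | yes refl = at-c
... | no a≢c = others a a≢c

transfer-except : ∀ {k n} {p : Permutation′ k} {R R' : Region k} {w : Permutation′ n} {ι : Fin k → Fin n}
  → Vincular R → Occurrence p R w ι → ∀ c → (∀ a → a ≢ c → Shaded R' a → Shaded R a)
  → (Shaded R' c → ¬ Shaded R c → Contains w p R') → Contains w p R'
transfer-except {p = p} {R} {R'} {w} vR occ c others repair with shaded? R c | shaded? R' c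
... | yes s | _ = _ , transfer {p = p} {w = w} vR (columns-except c (λ _ → s) others) occ
... | no _ | no ¬s' = _ , transfer {p = p} {w = w} vR (columns-except c (λ s' → contradiction s' ¬s') others) occ
... | no ¬s | yes s' = repair s' ¬s

Tabulates : ∀ {k} → Permutation′ k → (Fin k → Fin k) → Set
Tabulates p g = ∀ i → p ⟨$⟩ʳ i ≡ g i

-- For a tabulated p, membership in G(p) is decided by evaluating the table, which
-- settles pointless squares and frames of diagonals by computation.
module Tabulated {k} (p : Permutation′ k) {g : Fin k → Fin k} (p≗g : Tabulates p g) where

  graph? : ∀ x y → Dec (∃ λ i → suc (toℕ i) ≡ x × suc (toℕ (g i)) ≡ y)
  graph? x y = any? (λ i → (suc (toℕ i) ℕ.≟ x) ×-dec (suc (toℕ (g i)) ℕ.≟ y))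

  absent : ∀ x y → {False (graph? x y)} → ¬ InG p x y
  absent x y {no-point} (i , ex , ey) =
    toWitnessFalse no-point (i , ex , trans (cong (λ j → suc (toℕ j)) (sym (p≗g i))) ey)

  present : ∀ x y → {True (graph? x y)} → InG p x y
  present x y {point} with toWitness point
  ... | i , ex , ey = i , ex , trans (cong (λ j → suc (toℕ j)) (p≗g i)) ey

  pointless : ∀ a b → {False (graph? a b)} → {False (graph? (suc a) b)}
    → {False (graph? a (suc b))} → {False (graph? (suc a) (suc b))} → Pointless p a b
  pointless a b {c₁} {c₂} {c₃} {c₄} =
    absent a b {c₁} , absent (suc a) b {c₂} , absent a (suc b) {c₃} , absent (suc a) (suc b) {c₄}

  ne-frame : ∀ a b → {False (graph? (a + 0) (b + 0))} → {True (graph? (a + 1) (b + 1))}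
    → {False (graph? (a + 2) (b + 2))} → NEFrame p a b
  ne-frame a b {c₀} {c₁} {c₂} =
    frame (absent (a + 0) (b + 0) {c₀}) (present (a + 1) (b + 1) {c₁}) (absent (a + 2) (b + 2) {c₂})

  se-frame : ∀ a b → {False (graph? (a + 0) (suc b ∸ 0))} → {True (graph? (a + 1) (suc b ∸ 1))}
    → {False (graph? (a + 2) (suc b ∸ 2))} → SEFrame p a b
  se-frame a b {c₀} {c₁} {c₂} =
    frame (absent (a + 0) (suc b ∸ 0) {c₀}) (present (a + 1) (suc b ∸ 1) {c₁}) (absent (a + 2) (suc b ∸ 2) {c₂})

  value-order : ∀ {n} (w : Permutation′ n) (ι : Fin k → Fin n) → OrderIso p w ι
    → ∀ u v → toℕ (g u) < toℕ (g v) → (w ⟨$⟩ʳ ι u) Fin.< (w ⟨$⟩ʳ ι v)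
  value-order w ι iso u v lt =
    Equivalence.from (iso u v) (subst₂ (λ a b → toℕ a < toℕ b) (sym (p≗g u)) (sym (p≗g v)) lt)

couple : ∀ {n} → Fin n → Fin n → Fin 2 → Fin n
couple a b 0F = a
couple a b 1F = b

triple : ∀ {n} → Fin n → Fin n → Fin n → Fin 3 → Fin n
triple a b c 0F = a
triple a b c 1F = b
triple a b c 2F = c

couple-increasing : ∀ {n} {a b : Fin n} → toℕ a < toℕ b → Increasing (couple a b)
couple-increasing a<b 0F 1F _ = a<b
couple-increasing a<b 0F 0F ()
couple-increasing a<b 1F 0F ()
couple-increasing a<b 1F 1F (s≤s ())

triple-increasing : ∀ {n} {a b c : Fin n} → toℕ a < toℕ b → toℕ b < toℕ c → Increasing (triple a b c)
triple-increasing a<b b<c 0F 1F _ = a<b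
triple-increasing a<b b<c 0F 2F _ = ℕₚ.<-trans a<b b<c
triple-increasing a<b b<c 1F 2F _ = b<c
triple-increasing a<b b<c 0F 0F ()
triple-increasing a<b b<c 1F 0F ()
triple-increasing a<b b<c 1F 1F (s≤s ())
triple-increasing a<b b<c 2F 0F ()
triple-increasing a<b b<c 2F 1F (s≤s ())
triple-increasing a<b b<c 2F 2F (s≤s (s≤s ()))

inverse-at : ∀ {k} (p : Permutation′ k) {s t} → p ⟨$⟩ʳ s ≡ t → p ⟨$⟩ˡ t ≡ s
inverse-at p e = trans (cong (p ⟨$⟩ˡ_) (sym e)) (inverseˡ p)

-- Order-isomorphism to a pattern of length 2 or 3, checked on consecutive values:
-- s_b is the index with p(s_b) = b.
order-iso₂ : ∀ {n} (p : Permutation′ 2) (x : Fin 2 → Fin n) {s₀ s₁}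
  → p ⟨$⟩ʳ s₀ ≡ 0F → p ⟨$⟩ʳ s₁ ≡ 1F → x s₀ Fin.< x s₁
  → ∀ u v → (x u Fin.< x v ⇔ (p ⟨$⟩ʳ u) Fin.< (p ⟨$⟩ʳ v))
order-iso₂ p x e₀ e₁ x₀₁ = order-iso p x increasing
  where
  increasing : ∀ s t → s Fin.< t → x (p ⟨$⟩ˡ s) Fin.< x (p ⟨$⟩ˡ t)
  increasing 0F 1F _ = subst₂ (λ a b → x a Fin.< x b) (sym (inverse-at p e₀)) (sym (inverse-at p e₁)) x₀₁
  increasing 0F 0F ()
  increasing 1F 0F ()
  increasing 1F 1F (s≤s ())

order-iso₃ : ∀ {n} (p : Permutation′ 3) (x : Fin 3 → Fin n) {s₀ s₁ s₂}
  → p ⟨$⟩ʳ s₀ ≡ 0F → p ⟨$⟩ʳ s₁ ≡ 1F → p ⟨$⟩ʳ s₂ ≡ 2F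
  → x s₀ Fin.< x s₁ → x s₁ Fin.< x s₂
  → ∀ u v → (x u Fin.< x v ⇔ (p ⟨$⟩ʳ u) Fin.< (p ⟨$⟩ʳ v))
order-iso₃ p x e₀ e₁ e₂ x₀₁ x₁₂ = order-iso p x increasing
  where
  y : Fin 3 → Fin _
  y t = x (p ⟨$⟩ˡ t)
  y₀₁ : y 0F Fin.< y 1F
  y₀₁ = subst₂ (λ a b → x a Fin.< x b) (sym (inverse-at p e₀)) (sym (inverse-at p e₁)) x₀₁
  y₁₂ : y 1F Fin.< y 2F
  y₁₂ = subst₂ (λ a b → x a Fin.< x b) (sym (inverse-at p e₁)) (sym (inverse-at p e₂)) x₁₂
  increasing : ∀ s t → s Fin.< t → y s Fin.< y t
  increasing 0F 1F _ = y₀₁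
  increasing 0F 2F _ = ℕₚ.<-trans y₀₁ y₁₂
  increasing 1F 2F _ = y₁₂
  increasing 0F 0F ()
  increasing 1F 0F ()
  increasing 1F 1F (s≤s ())
  increasing 2F 0F ()
  increasing 2F 1F (s≤s ())
  increasing 2F 2F (s≤s (s≤s ()))

other-side : ∀ {n} (w : Permutation′ n) {x y : Fin n} → x ≢ y
  → ¬ ((w ⟨$⟩ʳ x) Fin.< (w ⟨$⟩ʳ y)) → (w ⟨$⟩ʳ y) Fin.< (w ⟨$⟩ʳ x)
other-side w {x} {y} x≢y ≮ with ℕₚ.<-cmp (toℕ (w ⟨$⟩ʳ x)) (toℕ (w ⟨$⟩ʳ y))
... | tri< lt _ _ = contradiction lt ≮
... | tri≈ _ eq _ = contradiction (permutation-injective w (toℕ-injective eq)) x≢y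
... | tri> _ _ gt = gt

record Crossing {n} (P : Fin n → Set) (x y : Fin n) : Set where
  field
    left right : Fin n
    adjacent : toℕ right ≡ suc (toℕ left)
    after-x : toℕ x ≤ toℕ left
    before-y : toℕ right ≤ toℕ y
    holds : P left
    fails : ¬ P right

crossing : ∀ {n} {P : Fin n → Set} → (∀ m → Dec (P m)) → ∀ {x y : Fin n}
  → toℕ x < toℕ y → P x → ¬ P y → Crossing P x y
crossing {n} {P} P? {x} {y} x<y Px ¬Py = search (toℕ y ∸ suc (toℕ x)) y distance ¬Py
  where
  distance : toℕ y ≡ suc (toℕ y ∸ suc (toℕ x) + toℕ x)
  distance = sym (trans (sym (ℕₚ.+-suc _ (toℕ x))) (ℕₚ.m∸n+n≡m x<y))
  step-back : ∀ d (z : Fin n) → toℕ z ≡ suc (suc d + toℕ x) → Σ (Fin n) λ m → toℕ m ≡ suc d + toℕ x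
  step-back d z e = fromℕ< m<n , toℕ-fromℕ< m<n
    where
    m<n : suc d + toℕ x < n
    m<n = ℕₚ.<⇒≤ (subst (_< n) e (toℕ<n z))
  widen : ∀ {m z : Fin n} → toℕ m ≤ toℕ z → Crossing P x m → Crossing P x z
  widen m≤z c = record { Crossing c ; before-y = ℕₚ.≤-trans (Crossing.before-y c) m≤z }
  -- z lies d+1 steps right of x and P fails at z: inspect the left neighbour of z.
  search : ∀ d (z : Fin n) → toℕ z ≡ suc d + toℕ x → ¬ P z → Crossing P x z
  search zero z e ¬Pz = record
    { left = x ; right = z ; adjacent = e ; after-x = ℕₚ.≤-refl ; before-y = ℕₚ.≤-refl
    ; holds = Px ; fails = ¬Pz }
  search (suc d) z e ¬Pz with step-back d z e
  ... | m , em with P? m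
  ...   | yes Pm = record
    { left = m ; right = z ; adjacent = trans e (cong suc (sym em))
    ; after-x = subst (toℕ x ≤_) (sym em) (ℕₚ.m≤n+m (toℕ x) (suc d)) ; before-y = ℕₚ.≤-refl
    ; holds = Pm ; fails = ¬Pz }
  ...   | no ¬Pm = widen (ℕₚ.≤-trans (ℕₚ.n≤1+n _) (ℕₚ.≤-reflexive (sym (trans e (cong suc (sym em))))))
                     (search d m em ¬Pm)

adjacent-gap : ∀ {n} {j j' x : Fin n} → toℕ j' ≡ suc (toℕ j)
  → ¬ (suc (toℕ j) < suc (toℕ x) × suc (toℕ x) < suc (toℕ j'))
adjacent-gap {x = x} j'≡j+1 (s≤s j<x , s≤s x<j') =
  ℕₚ.<⇒≱ j<x (ℕₚ.≤-pred (subst (toℕ x <_) j'≡j+1 x<j'))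

adjacent⇒< : ∀ {n} {j j' : Fin n} → toℕ j' ≡ suc (toℕ j) → toℕ j < toℕ j'
adjacent⇒< j'≡j+1 = ℕₚ.≤-reflexive (sym j'≡j+1)

-- Repairs for k = 2, 3.  R' shades a column c without pointless square that R leaves
-- unshaded, R' leaves the neighbouring columns unshaded, and the two chosen entries
-- around c are replaced by an adjacent pair j, j' = j+1, so that the gap below c is empty.
-- k = 2, c = 1: the new occurrence is (j, j').
slide₂ : ∀ {n} {p : Permutation′ 2} {R' : Region 2} {w : Permutation′ n}
  → ¬ Shaded R' 0F → ¬ Shaded R' 2F
  → ∀ {j j'} → toℕ j' ≡ suc (toℕ j) → OrderIso p w (couple j j') → Contains w p R'
slide₂ {p = p} {R'} {w} ¬s₀ ¬s₂ {j} {j'} adj iso =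
  couple j j' , occurrence-from-gaps {p = p} {R = R'} {w = w} (couple-increasing (adjacent⇒< adj)) iso empty
  where
  empty : ∀ a → Shaded R' a → ∀ x → ¬ InGap (couple j j') a x
  empty 0F s = contradiction s ¬s₀
  empty 1F _ _ = adjacent-gap adj
  empty 2F s = contradiction s ¬s₂

-- k = 3, c = 1: the new occurrence is (j, j', ι₂); column 3 keeps its old gap.
slide₃-left : ∀ {n} {p : Permutation′ 3} {R R' : Region 3} {w : Permutation′ n} {ι : Fin 3 → Fin n}
  → Vincular R → Occurrence p R w ι → (Shaded R' 3F → Shaded R 3F) → ¬ Shaded R' 0F → ¬ Shaded R' 2F
  → ∀ {j j'} → toℕ j' ≡ suc (toℕ j) → toℕ j' < toℕ (ι 2F) → OrderIso p w (triple j j' (ι 2F))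
  → Contains w p R'
slide₃-left {p = p} {R} {R'} {w} {ι} vR occ keep₃ ¬s₀ ¬s₂ {j} {j'} adj j'<ι₂ iso =
  triple j j' (ι 2F) ,
  occurrence-from-gaps {p = p} {R = R'} {w = w} (triple-increasing (adjacent⇒< adj) j'<ι₂) iso empty
  where
  empty : ∀ a → Shaded R' a → ∀ x → ¬ InGap (triple j j' (ι 2F)) a x
  empty 0F s = contradiction s ¬s₀
  empty 1F _ _ = adjacent-gap adj
  empty 2F s = contradiction s ¬s₂
  empty 3F s = gap-empty {p = p} {R = R} {w = w} vR occ (keep₃ s)

-- k = 3, c = 2: the new occurrence is (ι₀, j, j'); column 0 keeps its old gap.
slide₃-right : ∀ {n} {p : Permutation′ 3} {R R' : Region 3} {w : Permutation′ n} {ι : Fin 3 → Fin n}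
  → Vincular R → Occurrence p R w ι → (Shaded R' 0F → Shaded R 0F) → ¬ Shaded R' 1F → ¬ Shaded R' 3F
  → ∀ {j j'} → toℕ j' ≡ suc (toℕ j) → toℕ (ι 0F) < toℕ j → OrderIso p w (triple (ι 0F) j j')
  → Contains w p R'
slide₃-right {p = p} {R} {R'} {w} {ι} vR occ keep₀ ¬s₁ ¬s₃ {j} {j'} adj ι₀<j iso =
  triple (ι 0F) j j' ,
  occurrence-from-gaps {p = p} {R = R'} {w = w} (triple-increasing ι₀<j (adjacent⇒< adj)) iso empty
  where
  empty : ∀ a → Shaded R' a → ∀ x → ¬ InGap (triple (ι 0F) j j') a x
  empty 0F s = gap-empty {p = p} {R = R} {w = w} vR occ (keep₀ s)
  empty 1F s = contradiction s ¬s₁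
  empty 2F _ _ = adjacent-gap adj
  empty 3F s = contradiction s ¬s₃

-- p = 132.  Columns 0, 2, 3 contain pointless squares, column 1 does not.  If R'
-- shades column 1 and R does not, the enclosed NE-diagonals at (0,0) and (1,2) keep
-- columns 0 and 2 unshaded in R', and the first two entries slide to the adjacent
-- pair where w climbs over the value of the third entry.
monotone-132 : ∀ (p : Permutation′ 3) → Tabulates p (triple 0F 2F 1F) → EncMonotone p
monotone-132 p p≗g {R} {R'} vR vR' enc⊆ w (ι , occ@(inc , iso , _)) =
  transfer-except {p = p} {w = w} vR occ 1F others repair
  where
  open Tabulated p p≗g
  open EnclosedDiagonals p vR' enc⊆
  others : ∀ a → a ≢ 1F → Shaded R' a → Shaded R a
  others 0F _ = pointless-shaded 0F 2F (pointless 0 2)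
  others 1F 1≢1 = contradiction refl 1≢1
  others 2F _ = pointless-shaded 2F 0F (pointless 2 0)
  others 3F _ = pointless-shaded 3F 0F (pointless 3 0)
  repair : Shaded R' 1F → ¬ Shaded R 1F → Contains w p R'
  repair s₁ ¬s₁ =
    slide₃-left {p = p} {R} {R'} {w} {ι} vR occ (others 3F (λ ())) ¬s₀ ¬s₂ {left} {right} adjacent j'<ι₂
      (order-iso₃ p _ (p≗g 0F) (p≗g 2F) (p≗g 1F) holds (other-side w (<⇒≢ j'<ι₂) fails))
    where
    open Crossing (crossing (λ m → (w ⟨$⟩ʳ m) <ᶠ? (w ⟨$⟩ʳ ι 2F))
      {ι 0F} {ι 1F} (inc 0F 1F (s≤s z≤n))
      (value-order w ι iso 0F 2F (s≤s z≤n))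
      (λ h → ℕₚ.<-asym h (value-order w ι iso 2F 1F (s≤s (s≤s z≤n)))))
    ¬s₀ : ¬ Shaded R' 0F
    ¬s₀ s₀ = ¬s₁ (proj₂ (pair-NE 0F 1F 0F 1F refl refl (ne-frame 0 0) s₀ s₁))
    ¬s₂ : ¬ Shaded R' 2F
    ¬s₂ s₂ = ¬s₁ (proj₁ (pair-NE 1F 2F 2F 3F refl refl (ne-frame 1 2) s₁ s₂))
    j'<ι₂ : toℕ right < toℕ (ι 2F)
    j'<ι₂ = ℕₚ.≤-<-trans before-y (inc 1F 2F (s≤s (s≤s z≤n)))

-- p = 312, the complement of 132: the same repair with w descending below the third
-- entry; the enclosed diagonals are NE at (0,2) and SE at (1,1).
monotone-312 : ∀ (p : Permutation′ 3) → Tabulates p (triple 2F 0F 1F) → EncMonotone p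
monotone-312 p p≗g {R} {R'} vR vR' enc⊆ w (ι , occ@(inc , iso , _)) =
  transfer-except {p = p} {w = w} vR occ 1F others repair
  where
  open Tabulated p p≗g
  open EnclosedDiagonals p vR' enc⊆
  others : ∀ a → a ≢ 1F → Shaded R' a → Shaded R a
  others 0F _ = pointless-shaded 0F 0F (pointless 0 0)
  others 1F 1≢1 = contradiction refl 1≢1
  others 2F _ = pointless-shaded 2F 3F (pointless 2 3)
  others 3F _ = pointless-shaded 3F 0F (pointless 3 0)
  repair : Shaded R' 1F → ¬ Shaded R 1F → Contains w p R'
  repair s₁ ¬s₁ =
    slide₃-left {p = p} {R} {R'} {w} {ι} vR occ (others 3F (λ ())) ¬s₀ ¬s₂ {left} {right} adjacent j'<ι₂
      (order-iso₃ p _ (p≗g 1F) (p≗g 2F) (p≗g 0F) (other-side w (≢-sym (<⇒≢ j'<ι₂)) fails) holds)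
    where
    open Crossing (crossing (λ m → (w ⟨$⟩ʳ ι 2F) <ᶠ? (w ⟨$⟩ʳ m))
      {ι 0F} {ι 1F} (inc 0F 1F (s≤s z≤n))
      (value-order w ι iso 2F 0F (s≤s (s≤s z≤n)))
      (λ h → ℕₚ.<-asym h (value-order w ι iso 1F 2F (s≤s z≤n))))
    ¬s₀ : ¬ Shaded R' 0F
    ¬s₀ s₀ = ¬s₁ (proj₂ (pair-NE 0F 1F 2F 3F refl refl (ne-frame 0 2) s₀ s₁))
    ¬s₂ : ¬ Shaded R' 2F
    ¬s₂ s₂ = ¬s₁ (proj₁ (pair-SE 1F 2F 1F 0F refl refl (se-frame 1 1) s₁ s₂))
    j'<ι₂ : toℕ right < toℕ (ι 2F)
    j'<ι₂ = ℕₚ.≤-<-trans before-y (inc 1F 2F (s≤s (s≤s z≤n)))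

-- p = 213, the reverse of 312: column 2 lacks a pointless square; the
-- enclosed NE-diagonals at (1,0) and (2,2) guard columns 1 and 3, and the last two
-- entries slide to the adjacent pair where w drops below the first entry.
monotone-213 : ∀ (p : Permutation′ 3) → Tabulates p (triple 1F 0F 2F) → EncMonotone p
monotone-213 p p≗g {R} {R'} vR vR' enc⊆ w (ι , occ@(inc , iso , _)) =
  transfer-except {p = p} {w = w} vR occ 2F others repair
  where
  open Tabulated p p≗g
  open EnclosedDiagonals p vR' enc⊆
  others : ∀ a → a ≢ 2F → Shaded R' a → Shaded R a
  others 0F _ = pointless-shaded 0F 0F (pointless 0 0)
  others 1F _ = pointless-shaded 1F 3F (pointless 1 3)
  others 2F 2≢2 = contradiction refl 2≢2
  others 3F _ = pointless-shaded 3F 0F (pointless 3 0)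
  repair : Shaded R' 2F → ¬ Shaded R 2F → Contains w p R'
  repair s₂ ¬s₂ =
    slide₃-right {p = p} {R} {R'} {w} {ι} vR occ (others 0F (λ ())) ¬s₁ ¬s₃ {left} {right} adjacent ι₀<j
      (order-iso₃ p _ (p≗g 1F) (p≗g 0F) (p≗g 2F) holds (other-side w j'≢ι₀ fails))
    where
    open Crossing (crossing (λ m → (w ⟨$⟩ʳ m) <ᶠ? (w ⟨$⟩ʳ ι 0F))
      {ι 1F} {ι 2F} (inc 1F 2F (s≤s (s≤s z≤n)))
      (value-order w ι iso 1F 0F (s≤s z≤n))
      (λ h → ℕₚ.<-asym h (value-order w ι iso 0F 2F (s≤s (s≤s z≤n)))))
    ¬s₁ : ¬ Shaded R' 1F
    ¬s₁ s₁ = ¬s₂ (proj₂ (pair-NE 1F 2F 0F 1F refl refl (ne-frame 1 0) s₁ s₂))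
    ¬s₃ : ¬ Shaded R' 3F
    ¬s₃ s₃ = ¬s₂ (proj₁ (pair-NE 2F 3F 2F 3F refl refl (ne-frame 2 2) s₂ s₃))
    ι₀<j : toℕ (ι 0F) < toℕ left
    ι₀<j = ℕₚ.<-≤-trans (inc 0F 1F (s≤s z≤n)) after-x
    j'≢ι₀ : right ≢ ι 0F
    j'≢ι₀ = ≢-sym (<⇒≢ (ℕₚ.<-trans ι₀<j (adjacent⇒< adjacent)))

-- p = 231, the complement of 213: the last two entries slide to where w climbs over the
-- first entry; the enclosed SE-diagonals at (1,3) and (2,1) guard columns 1 and 3.
monotone-231 : ∀ (p : Permutation′ 3) → Tabulates p (triple 1F 2F 0F) → EncMonotone p
monotone-231 p p≗g {R} {R'} vR vR' enc⊆ w (ι , occ@(inc , iso , _)) =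
  transfer-except {p = p} {w = w} vR occ 2F others repair
  where
  open Tabulated p p≗g
  open EnclosedDiagonals p vR' enc⊆
  others : ∀ a → a ≢ 2F → Shaded R' a → Shaded R a
  others 0F _ = pointless-shaded 0F 0F (pointless 0 0)
  others 1F _ = pointless-shaded 1F 0F (pointless 1 0)
  others 2F 2≢2 = contradiction refl 2≢2
  others 3F _ = pointless-shaded 3F 2F (pointless 3 2)
  repair : Shaded R' 2F → ¬ Shaded R 2F → Contains w p R'
  repair s₂ ¬s₂ =
    slide₃-right {p = p} {R} {R'} {w} {ι} vR occ (others 0F (λ ())) ¬s₁ ¬s₃ {left} {right} adjacent ι₀<j
      (order-iso₃ p _ (p≗g 2F) (p≗g 0F) (p≗g 1F) (other-side w (≢-sym j'≢ι₀) fails) holds)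
    where
    open Crossing (crossing (λ m → (w ⟨$⟩ʳ ι 0F) <ᶠ? (w ⟨$⟩ʳ m))
      {ι 1F} {ι 2F} (inc 1F 2F (s≤s (s≤s z≤n)))
      (value-order w ι iso 0F 1F (s≤s (s≤s z≤n)))
      (λ h → ℕₚ.<-asym h (value-order w ι iso 2F 0F (s≤s z≤n))))
    ¬s₁ : ¬ Shaded R' 1F
    ¬s₁ s₁ = ¬s₂ (proj₂ (pair-SE 1F 2F 3F 2F refl refl (se-frame 1 3) s₁ s₂))
    ¬s₃ : ¬ Shaded R' 3F
    ¬s₃ s₃ = ¬s₂ (proj₁ (pair-SE 2F 3F 1F 0F refl refl (se-frame 2 1) s₂ s₃))
    ι₀<j : toℕ (ι 0F) < toℕ left
    ι₀<j = ℕₚ.<-≤-trans (inc 0F 1F (s≤s z≤n)) after-x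
    j'≢ι₀ : right ≢ ι 0F
    j'≢ι₀ = ≢-sym (<⇒≢ (ℕₚ.<-trans ι₀<j (adjacent⇒< adjacent)))

-- p = 12: column 1 lacks a pointless square; the enclosed SE-diagonals at (0,1) and
-- (1,2) guard columns 0 and 2, and both entries slide to the adjacent pair where w
-- climbs to the value of the second entry.
monotone-12 : ∀ (p : Permutation′ 2) → Tabulates p (couple 0F 1F) → EncMonotone p
monotone-12 p p≗g {R} {R'} vR vR' enc⊆ w (ι , occ@(inc , iso , _)) =
  transfer-except {p = p} {w = w} vR occ 1F others repair
  where
  open Tabulated p p≗g
  open EnclosedDiagonals p vR' enc⊆
  others : ∀ a → a ≢ 1F → Shaded R' a → Shaded R a
  others 0F _ = pointless-shaded 0F 2F (pointless 0 2)
  others 1F 1≢1 = contradiction refl 1≢1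
  others 2F _ = pointless-shaded 2F 0F (pointless 2 0)
  repair : Shaded R' 1F → ¬ Shaded R 1F → Contains w p R'
  repair s₁ ¬s₁ =
    slide₂ {p = p} {R'} {w} ¬s₀ ¬s₂ {left} {right} adjacent
      (order-iso₂ p _ (p≗g 0F) (p≗g 1F) (ℕₚ.<-≤-trans holds (ℕₚ.≮⇒≥ fails)))
    where
    open Crossing (crossing (λ m → (w ⟨$⟩ʳ m) <ᶠ? (w ⟨$⟩ʳ ι 1F))
      {ι 0F} {ι 1F} (inc 0F 1F (s≤s z≤n))
      (value-order w ι iso 0F 1F (s≤s z≤n)) (ℕₚ.<-irrefl refl))
    ¬s₀ : ¬ Shaded R' 0F
    ¬s₀ s₀ = ¬s₁ (proj₂ (pair-SE 0F 1F 1F 0F refl refl (se-frame 0 1) s₀ s₁))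
    ¬s₂ : ¬ Shaded R' 2F
    ¬s₂ s₂ = ¬s₁ (proj₁ (pair-SE 1F 2F 2F 1F refl refl (se-frame 1 2) s₁ s₂))

-- p = 21, the complement of 12, with the enclosed NE-diagonals at (0,1) and (1,0).
monotone-21 : ∀ (p : Permutation′ 2) → Tabulates p (couple 1F 0F) → EncMonotone p
monotone-21 p p≗g {R} {R'} vR vR' enc⊆ w (ι , occ@(inc , iso , _)) =
  transfer-except {p = p} {w = w} vR occ 1F others repair
  where
  open Tabulated p p≗g
  open EnclosedDiagonals p vR' enc⊆
  others : ∀ a → a ≢ 1F → Shaded R' a → Shaded R a
  others 0F _ = pointless-shaded 0F 0F (pointless 0 0)
  others 1F 1≢1 = contradiction refl 1≢1
  others 2F _ = pointless-shaded 2F 2F (pointless 2 2)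
  repair : Shaded R' 1F → ¬ Shaded R 1F → Contains w p R'
  repair s₁ ¬s₁ =
    slide₂ {p = p} {R'} {w} ¬s₀ ¬s₂ {left} {right} adjacent
      (order-iso₂ p _ (p≗g 1F) (p≗g 0F) (ℕₚ.≤-<-trans (ℕₚ.≮⇒≥ fails) holds))
    where
    open Crossing (crossing (λ m → (w ⟨$⟩ʳ ι 1F) <ᶠ? (w ⟨$⟩ʳ m))
      {ι 0F} {ι 1F} (inc 0F 1F (s≤s z≤n))
      (value-order w ι iso 1F 0F (s≤s z≤n)) (ℕₚ.<-irrefl refl))
    ¬s₀ : ¬ Shaded R' 0F
    ¬s₀ s₀ = ¬s₁ (proj₂ (pair-NE 0F 1F 1F 2F refl refl (ne-frame 0 1) s₀ s₁))
    ¬s₂ : ¬ Shaded R' 2F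
    ¬s₂ s₂ = ¬s₁ (proj₁ (pair-NE 1F 2F 0F 1F refl refl (ne-frame 1 0) s₁ s₂))

only : (i : Fin 1) → i ≡ 0F
only 0F = refl

single-entry : ∀ {n} {p : Permutation′ 1} {R' : Region 1} {w : Permutation′ n} {x : Fin n}
  → (∀ a → Shaded R' a → ∀ y → ¬ InGap (λ _ → x) a y) → Occurrence p R' w (λ _ → x)
single-entry {p = p} {R'} {w} {x} empty =
  occurrence-from-gaps {p = p} {R = R'} {w = w} (λ { 0F 0F () }) (order-iso p _ (λ { 0F 0F () })) empty

-- p = 1.  Neither column has a pointless square.  If R' shades both, so does R (the
-- enclosed NE-diagonal at (0,0)); if R' shades only column 0 (resp. 1), the first
-- (resp. last) entry of w is an occurrence of (p,R').
monotone-1 : ∀ (p : Permutation′ 1) → EncMonotone p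
monotone-1 p vR vR' enc⊆ {zero} w (ι , _) with ι 0F
... | ()
monotone-1 p {R} {R'} vR vR' enc⊆ {suc n} w (ι , occ) with shaded? R' 0F | shaded? R' 1F
... | yes s₀ | yes s₁ = ι , transfer {p = p} {w = w} vR both occ
  where
  open Tabulated p {g = λ _ → 0F} (λ i → only (p ⟨$⟩ʳ i))
  shaded-both : Shaded R 0F × Shaded R 1F
  shaded-both = EnclosedDiagonals.pair-NE p vR' enc⊆ 0F 1F 0F 1F refl refl (ne-frame 0 0) s₀ s₁
  both : ∀ a → Shaded R' a → Shaded R a
  both 0F _ = proj₁ shaded-both
  both 1F _ = proj₂ shaded-both
... | no ¬s₀ | no ¬s₁ = ι , transfer {p = p} {w = w} vR neither occ
  where
  neither : ∀ a → Shaded R' a → Shaded R a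
  neither 0F s₀ = contradiction s₀ ¬s₀
  neither 1F s₁ = contradiction s₁ ¬s₁
... | yes _ | no ¬s₁ = (λ _ → 0F) , single-entry {p = p} {R'} {w} empty
  where
  empty : ∀ a → Shaded R' a → ∀ x → ¬ InGap {n = suc n} (λ _ → 0F) a x
  empty 0F _ x (_ , s≤s ())
  empty 1F s₁ = contradiction s₁ ¬s₁
... | no ¬s₀ | yes _ = (λ _ → fromℕ n) , single-entry {p = p} {R'} {w} empty
  where
  empty : ∀ a → Shaded R' a → ∀ x → ¬ InGap (λ _ → fromℕ n) a x
  empty 0F s₀ = contradiction s₀ ¬s₀
  empty 1F _ x (lo , _) =
    ℕₚ.<⇒≱ (subst (_< toℕ x) (toℕ-fromℕ n) (ℕₚ.≤-pred lo)) (ℕₚ.≤-pred (toℕ<n x))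

-- The empty pattern: G(p) is empty, so the single square is pointless.
monotone-0 : ∀ (p : Permutation′ 0) → EncMonotone p
monotone-0 p = monotone-pointless p λ { 0F → 0F , no-point , no-point , no-point , no-point }
  where
  no-point : ∀ {x y} → ¬ InG p x y
  no-point (() , _)

-- p = 123 and p = 321: every column contains a pointless square.
monotone-123 : ∀ (p : Permutation′ 3) → Tabulates p (triple 0F 1F 2F) → EncMonotone p
monotone-123 p p≗g = monotone-pointless p λ
  { 0F → 2F , pointless 0 2 ; 1F → 3F , pointless 1 3 ; 2F → 0F , pointless 2 0 ; 3F → 0F , pointless 3 0 }
  where open Tabulated p p≗g

monotone-321 : ∀ (p : Permutation′ 3) → Tabulates p (triple 2F 1F 0F) → EncMonotone p
monotone-321 p p≗g = monotone-pointless p λ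
  { 0F → 0F , pointless 0 0 ; 1F → 0F , pointless 1 0 ; 2F → 3F , pointless 2 3 ; 3F → 2F , pointless 3 2 }
  where open Tabulated p p≗g

data Shape₂ (p : Permutation′ 2) : Set where
  is-12 : Tabulates p (couple 0F 1F) → Shape₂ p
  is-21 : Tabulates p (couple 1F 0F) → Shape₂ p

shape₂ : ∀ p → Shape₂ p
shape₂ p = sort (p ⟨$⟩ʳ 0F) (p ⟨$⟩ʳ 1F) refl refl (λ e → 0≢1 (permutation-injective p e))
  where
  0≢1 : 0F ≢ 1F
  0≢1 ()
  sort : ∀ a b → p ⟨$⟩ʳ 0F ≡ a → p ⟨$⟩ʳ 1F ≡ b → a ≢ b → Shape₂ p
  sort 0F 1F e₀ e₁ _ = is-12 λ { 0F → e₀ ; 1F → e₁ }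
  sort 1F 0F e₀ e₁ _ = is-21 λ { 0F → e₀ ; 1F → e₁ }
  sort 0F 0F _ _ a≢b = contradiction refl a≢b
  sort 1F 1F _ _ a≢b = contradiction refl a≢b

data Shape₃ (p : Permutation′ 3) : Set where
  is-123 : Tabulates p (triple 0F 1F 2F) → Shape₃ p
  is-132 : Tabulates p (triple 0F 2F 1F) → Shape₃ p
  is-213 : Tabulates p (triple 1F 0F 2F) → Shape₃ p
  is-231 : Tabulates p (triple 1F 2F 0F) → Shape₃ p
  is-312 : Tabulates p (triple 2F 0F 1F) → Shape₃ p
  is-321 : Tabulates p (triple 2F 1F 0F) → Shape₃ p

shape₃ : ∀ p → Shape₃ p
shape₃ p = sort (p ⟨$⟩ʳ 0F) (p ⟨$⟩ʳ 1F) (p ⟨$⟩ʳ 2F) refl refl refl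
               (distinct λ ()) (distinct λ ()) (distinct λ ())
  where
  distinct : ∀ {i j} → i ≢ j → p ⟨$⟩ʳ i ≢ p ⟨$⟩ʳ j
  distinct i≢j e = i≢j (permutation-injective p e)
  sort : ∀ a b c → p ⟨$⟩ʳ 0F ≡ a → p ⟨$⟩ʳ 1F ≡ b → p ⟨$⟩ʳ 2F ≡ c
    → a ≢ b → a ≢ c → b ≢ c → Shape₃ p
  sort 0F 1F 2F e₀ e₁ e₂ _ _ _ = is-123 λ { 0F → e₀ ; 1F → e₁ ; 2F → e₂ }
  sort 0F 2F 1F e₀ e₁ e₂ _ _ _ = is-132 λ { 0F → e₀ ; 1F → e₁ ; 2F → e₂ }
  sort 1F 0F 2F e₀ e₁ e₂ _ _ _ = is-213 λ { 0F → e₀ ; 1F → e₁ ; 2F → e₂ }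
  sort 1F 2F 0F e₀ e₁ e₂ _ _ _ = is-231 λ { 0F → e₀ ; 1F → e₁ ; 2F → e₂ }
  sort 2F 0F 1F e₀ e₁ e₂ _ _ _ = is-312 λ { 0F → e₀ ; 1F → e₁ ; 2F → e₂ }
  sort 2F 1F 0F e₀ e₁ e₂ _ _ _ = is-321 λ { 0F → e₀ ; 1F → e₁ ; 2F → e₂ }
  sort 0F 0F _ _ _ _ a≢b _ _ = contradiction refl a≢b
  sort 1F 1F _ _ _ _ a≢b _ _ = contradiction refl a≢b
  sort 2F 2F _ _ _ _ a≢b _ _ = contradiction refl a≢b
  sort 0F _ 0F _ _ _ _ a≢c _ = contradiction refl a≢c
  sort 1F _ 1F _ _ _ _ a≢c _ = contradiction refl a≢c
  sort 2F _ 2F _ _ _ _ a≢c _ = contradiction refl a≢c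
  sort _ 0F 0F _ _ _ _ _ b≢c = contradiction refl b≢c
  sort _ 1F 1F _ _ _ _ _ b≢c = contradiction refl b≢c
  sort _ 2F 2F _ _ _ _ _ b≢c = contradiction refl b≢c

enc-monotone : ∀ {k} (p : Permutation′ k) → EncMonotone p
enc-monotone {0} p = monotone-0 p
enc-monotone {1} p = monotone-1 p
enc-monotone {2} p with shape₂ p
... | is-12 p≗g = monotone-12 p p≗g
... | is-21 p≗g = monotone-21 p p≗g
enc-monotone {3} p with shape₃ p
... | is-123 p≗g = monotone-123 p p≗g
... | is-132 p≗g = monotone-132 p p≗g
... | is-213 p≗g = monotone-213 p p≗g
... | is-231 p≗g = monotone-231 p p≗g
... | is-312 p≗g = monotone-312 p p≗g
... | is-321 p≗g = monotone-321 p p≗g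
enc-monotone {suc (suc (suc (suc k)))} p =
  monotone-pointless p (pointless-row p (s≤s (s≤s (s≤s (s≤s z≤n)))))

same-columns⇒equal : ∀ {k} {R R' : Region k} → Vincular R → Vincular R'
  → (∀ a → Shaded R a → Shaded R' a) → (∀ a → Shaded R' a → Shaded R a) → ∀ a b → R a b ≡ R' a b
same-columns⇒equal {R = R} {R'} vR vR' R⊆R' R'⊆R a b with R a b in Rab | R' a b in R'ab
... | true | true = refl
... | false | false = refl
... | true | false = contradiction (trans (sym (column-full vR' (R⊆R' a (b , Rab)) b)) R'ab) λ ()
... | false | true = contradiction (trans (sym (column-full vR (R'⊆R a (b , R'ab)) b)) Rab) λ ()

proposition5p2 : ∀ {k : ℕ} (p : Permutation′ k) (R R' : Region k)
    → Vincular R → Vincular R'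
    → (∀ (d : Diag) → Enc p R d ⇔ Enc p R' d)
    → Coincident p R p R' × (3 < k → ∀ a b → R a b ≡ R' a b)
proposition5p2 {k} p R R' vR vR' enc≡ = coincident , equal
  where
  enc⊆ : ∀ d → Enc p R' d → Enc p R d
  enc⊆ d = Equivalence.from (enc≡ d)
  enc⊇ : ∀ d → Enc p R d → Enc p R' d
  enc⊇ d = Equivalence.to (enc≡ d)
  coincident : Coincident p R p R'
  coincident n w = mk⇔ (λ avoids contains → avoids (enc-monotone p vR' vR enc⊇ w contains))
                       (λ avoids contains → avoids (enc-monotone p vR vR' enc⊆ w contains))
  equal : 3 < k → ∀ a b → R a b ≡ R' a b
  equal 3<k = same-columns⇒equal vR vR'
    (EnclosedDiagonals.columns-pointless p vR enc⊇ (pointless-row p 3<k))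
    (EnclosedDiagonals.columns-pointless p vR' enc⊆ (pointless-row p 3<k))
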